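{- For every integer $n\ge 1$, the $n$-dimensional hypercube $Q_n$ satisfies $\chi_o(Q_n)=2$ if $n$ is odd and $\chi_o(Q_n)=4$ if $n$ is even.
   Context: $Q_n$ is the graph on $\{0,1\}^n$ in which two vectors are adjacent iff they differ in exactly one coordinate. A proper vertex coloring $\varphi$ of a graph $G$ is called an odd coloring if for every non-isolated vertex $x$ of $G$ there is a color $c$ such that the number of neighbors $y\in N(x)$ with $\varphi(y)=c$ is odd. The odd chromatic number $\chi_o(G)$ is the minimum number of colors in an odd coloring of $G$. -}

module Defs where

open import Data.Nat using (ℕ; suc; _<_)
open import Data.Nat.DivMod using (_%_)
open import Data.Bool using (Bool; not)
open import Data.Fin using (Fin; _≟_)
open import Data.Vec using (Vec; updateAt)
open import Data.List using (List; length; filter)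
open import Data.List.Base using (allFin)
open import Data.Product using (∃; _×_)
open import Relation.Binary.PropositionalEquality using (_≡_; _≢_)

Odd : ℕ → Set
Odd m = m % 2 ≡ 1

Even : ℕ → Set
Even m = m % 2 ≡ 0

Vertex : ℕ → Set
Vertex n = Vec Bool n

-- The neighbour of x obtained by flipping coordinate i.
-- The neighbours of x in Q_n are exactly flip i x for i : Fin n, pairwise distinct.
flip : ∀ {n} → Fin n → Vertex n → Vertex n
flip i x = updateAt x i not

nbrCount : ∀ {n k} → (Vertex n → Fin k) → Vertex n → Fin k → ℕ
nbrCount {n} φ x c = length (filter (λ i → φ (flip i x) ≟ c) (allFin n))

Proper : ∀ {n k} → (Vertex n → Fin k) → Set
Proper {n} φ = ∀ (x : Vertex n) (i : Fin n) → φ x ≢ φ (flip i x)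

-- Odd coloring of Q_n (for n ≥ 1 there are no isolated vertices; for n = 0 the
-- single vertex is isolated and imposes no parity condition).
IsOddColoring : ∀ {n k} → (Vertex n → Fin k) → Set
IsOddColoring {n} φ =
  Proper φ × (∀ (x : Vertex n) → 1 Data.Nat.≤ n → ∃ λ c → Odd (nbrCount φ x c))

HasOddColoring : ℕ → ℕ → Set
HasOddColoring n k = ∃ λ (φ : Vertex n → Fin k) → IsOddColoring φ

OddChromaticNumber : ℕ → ℕ → Set
OddChromaticNumber n m =
  HasOddColoring n m × (∀ k → k < m → HasOddColoring n k → Data.Empty.⊥)
  where import Data.Empty

{-# OPTIONS --safe #-}
-- Work over F₂. Let f_c be the indicator of colour class c and (M f) x = Σᵢ f (flip i x)
-- the adjacency operator of Q_n; a colouring φ is odd iff every vertex x has a colour c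
-- with (M f_c) x = 1. Since flip i and flip j commute and flip i is an involution,
-- M² = n·id. For n odd the weight-parity 2-colouring works; for n even the colouring by
-- (weight parity, first bit) gives each vertex exactly one neighbour of colour (opposite
-- parity, opposite first bit). Conversely, for n even Σ_c (M f_c) x = n = 0 and
-- (M f_{φ x}) x = 0, so the colours other than φ x have vanishing total. With two colours
-- this leaves no odd colour; with three, both other colours must be odd, i.e.
-- M f_c = 1 + f_c, and then M f_c = M (M f_c) = n f_c = 0, again a contradiction.
module Submission where

open import Defs
open import Data.Nat.Base using (ℕ; zero; suc; _≤_; _<_; s≤s; parity)
open import Data.Parity.Base using (Parity; 0ℙ; 1ℙ; _⁻¹; _+_; _*_)
open import Data.Parity.Properties
  using (+-0-commutativeMonoid; +-0-group; +-homo-+; +-assoc; +-identityʳ; p+p≡0ℙ;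
         *-identityʳ; *-distribʳ-+; ⁻¹-involutive; p≢p⁻¹)
open import Algebra.Properties.CommutativeMonoid.Sum +-0-commutativeMonoid
  using (sum-syntax; sum-cong-≗; sum-replicate-zero; ∑-distrib-+; ∑-comm; sum-remove)
open import Algebra.Properties.Group +-0-group using (inverseˡ-unique)
open import Data.Bool.Base using (Bool; true; false; not)
open import Data.Fin.Base using (Fin; zero; suc; punchIn; punchOut; combine)
open import Data.Fin.Properties using (_≟_; punchIn-punchOut; combine-injectiveˡ; combine-injectiveʳ)
open import Data.Vec.Base using ([]; _∷_; head; lookup; replicate)
open import Data.Vec.Properties using (updateAt-updateAt; updateAt-id-local; updateAt-commutes)
open import Data.Bool.Properties using (not-involutive)
open import Data.List.Base using (length; filter; tabulate)
open import Data.Product using (_×_; _,_; ∃; proj₁; map₂)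
open import Function.Base using (_∘_; id)
open import Relation.Nullary using (¬_; yes; no; does)
open import Relation.Nullary.Decidable using (dec-true; dec-false)
open import Relation.Unary using (Pred; Decidable)
open import Relation.Binary.PropositionalEquality
  using (_≡_; _≢_; refl; sym; trans; cong; cong₂; module ≡-Reasoning)

open ≡-Reasoning

toParity : Bool → Parity
toParity false = 0ℙ
toParity true  = 1ℙ

toParity-not : ∀ b → toParity (not b) ≡ toParity b ⁻¹
toParity-not false = refl
toParity-not true  = refl

fromParity : Parity → Fin 2
fromParity 0ℙ = zero
fromParity 1ℙ = suc zero

fromParity-injective : ∀ {p q} → fromParity p ≡ fromParity q → p ≡ q
fromParity-injective {0ℙ} {0ℙ} _ = refl
fromParity-injective {1ℙ} {1ℙ} _ = refl

parity-suc : ∀ m → parity (suc m) ≡ 1ℙ + parity m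
parity-suc m = +-homo-+ 1 m

odd⇒parity≡1ℙ : ∀ m → Odd m → parity m ≡ 1ℙ
odd⇒parity≡1ℙ 1             _ = refl
odd⇒parity≡1ℙ (suc (suc m)) o = odd⇒parity≡1ℙ m o

even⇒parity≡0ℙ : ∀ m → Even m → parity m ≡ 0ℙ
even⇒parity≡0ℙ 0             _ = refl
even⇒parity≡0ℙ (suc (suc m)) e = even⇒parity≡0ℙ m e

parity≡1ℙ⇒odd : ∀ m → parity m ≡ 1ℙ → Odd m
parity≡1ℙ⇒odd 1             _ = refl
parity≡1ℙ⇒odd (suc (suc m)) p = parity≡1ℙ⇒odd m p

parity-length-filter : ∀ {a p} {A : Set a} {P : Pred A p} (P? : Decidable P) {n} (g : Fin n → A) →
  parity (length (filter P? (tabulate g))) ≡ ∑[ i < n ] toParity (does (P? (g i)))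
parity-length-filter P? {zero}  g = refl
parity-length-filter P? {suc n} g with does (P? (g zero))
... | false = parity-length-filter P? (g ∘ suc)
... | true  = trans (parity-suc (length (filter P? (tabulate (g ∘ suc)))))
                    (cong (1ℙ +_) (parity-length-filter P? (g ∘ suc)))

∑-const : ∀ n p → ∑[ i < n ] p ≡ parity n * p
∑-const zero    p = refl
∑-const (suc n) p = begin
  p + ∑[ i < n ] p      ≡⟨ cong (p +_) (∑-const n p) ⟩
  p + (parity n * p)    ≡⟨ *-distribʳ-+ p 1ℙ (parity n) ⟨
  (1ℙ + parity n) * p   ≡⟨ cong (_* p) (parity-suc n) ⟨
  parity (suc n) * p    ∎

∑-1ℙ : ∀ n → ∑[ i < n ] 1ℙ ≡ parity n
∑-1ℙ n = trans (∑-const n 1ℙ) (*-identityʳ (parity n))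

∑-indicator : ∀ {k} (a : Fin k) → ∑[ c < k ] toParity (does (a ≟ c)) ≡ 1ℙ
∑-indicator {suc k} zero    = cong (1ℙ +_) (sum-replicate-zero k)
∑-indicator         (suc a) = ∑-indicator a

-- Over F₂ the off-diagonal terms of a symmetric double sum cancel in pairs.
∑-symmetric : ∀ {n} (f : Fin n → Fin n → Parity) → (∀ i j → f i j ≡ f j i) →
  ∑[ i < n ] ∑[ j < n ] f i j ≡ ∑[ i < n ] f i i
∑-symmetric {zero}  f f-sym = refl
∑-symmetric {suc n} f f-sym = begin
  (f₀₀ + r) + ∑[ i < n ] (f (suc i) zero + ∑[ j < n ] f (suc i) (suc j))
    ≡⟨ cong (f₀₀ + r +_) (∑-distrib-+ (λ i → f (suc i) zero) _) ⟩
  (f₀₀ + r) + (∑[ i < n ] f (suc i) zero + ∑[ i < n ] ∑[ j < n ] f (suc i) (suc j))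
    ≡⟨ cong₂ (λ s t → f₀₀ + r + (s + t))
         (sum-cong-≗ (λ i → f-sym (suc i) zero))
         (∑-symmetric (λ i j → f (suc i) (suc j)) (λ i j → f-sym (suc i) (suc j))) ⟩
  (f₀₀ + r) + (r + d)
    ≡⟨ +-assoc f₀₀ r (r + d) ⟩
  f₀₀ + (r + (r + d))
    ≡⟨ cong (f₀₀ +_) (+-assoc r r d) ⟨
  f₀₀ + ((r + r) + d)
    ≡⟨ cong (λ s → f₀₀ + (s + d)) (p+p≡0ℙ r) ⟩
  f₀₀ + d
    ∎
  where
  f₀₀ = f zero zero
  r = ∑[ j < n ] f zero (suc j)
  d = ∑[ i < n ] f (suc i) (suc i)

∑₂≡0ℙ⇒constant : (h : Fin 2 → Parity) → ∑[ j < 2 ] h j ≡ 0ℙ → ∀ i j → h i ≡ h j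
∑₂≡0ℙ⇒constant h h₀+h₁≡0 = constant
  where
  h₀≡h₁ : h zero ≡ h (suc zero)
  h₀≡h₁ = trans (inverseˡ-unique _ _ h₀+h₁≡0) (+-identityʳ _)
  constant : ∀ i j → h i ≡ h j
  constant zero       zero       = refl
  constant zero       (suc zero) = h₀≡h₁
  constant (suc zero) zero       = sym h₀≡h₁
  constant (suc zero) (suc zero) = refl

flip-involutive : ∀ {n} (i : Fin n) (x : Vertex n) → flip i (flip i x) ≡ x
flip-involutive i x = trans (updateAt-updateAt i x) (updateAt-id-local i x (not-involutive (lookup x i)))

flip-comm : ∀ {n} (i j : Fin n) (x : Vertex n) → flip j (flip i x) ≡ flip i (flip j x)
flip-comm i j x with i ≟ j
... | yes refl = refl
... | no  i≢j  = updateAt-commutes j i (i≢j ∘ sym) x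

adjacency : ∀ {n} → (Vertex n → Parity) → Vertex n → Parity
adjacency {n} f x = ∑[ i < n ] f (flip i x)

adjacency-⁻¹ : ∀ {n} (f : Vertex n → Parity) x →
  adjacency (λ y → f y ⁻¹) x ≡ parity n + adjacency f x
adjacency-⁻¹ {n} f x = begin
  ∑[ i < n ] (1ℙ + f (flip i x))   ≡⟨ ∑-distrib-+ (λ _ → 1ℙ) (λ i → f (flip i x)) ⟩
  ∑[ i < n ] 1ℙ + adjacency f x    ≡⟨ cong (_+ adjacency f x) (∑-1ℙ n) ⟩
  parity n + adjacency f x         ∎

adjacency² : ∀ {n} (f : Vertex n → Parity) x → adjacency (adjacency f) x ≡ parity n * f x
adjacency² {n} f x = begin
  ∑[ i < n ] ∑[ j < n ] f (flip j (flip i x))  ≡⟨ ∑-symmetric _ (λ i j → cong f (flip-comm i j x)) ⟩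
  ∑[ i < n ] f (flip i (flip i x))             ≡⟨ sum-cong-≗ (λ i → cong f (flip-involutive i x)) ⟩
  ∑[ i < n ] f x                               ≡⟨ ∑-const n (f x) ⟩
  parity n * f x                               ∎

colourClass : ∀ {n k} → (Vertex n → Fin k) → Fin k → Vertex n → Parity
colourClass φ c y = toParity (does (φ y ≟ c))

module _ {n k} (φ : Vertex n → Fin k) where

  colourClass-≡ : ∀ {c y} → φ y ≡ c → colourClass φ c y ≡ 1ℙ
  colourClass-≡ {c} {y} φy≡c = cong toParity (dec-true (φ y ≟ c) φy≡c)

  colourClass-≢ : ∀ {c y} → φ y ≢ c → colourClass φ c y ≡ 0ℙ
  colourClass-≢ {c} {y} φy≢c = cong toParity (dec-false (φ y ≟ c) φy≢c)

  nbrCount-parity : ∀ x c → parity (nbrCount φ x c) ≡ adjacency (colourClass φ c) x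
  nbrCount-parity x c = parity-length-filter (λ i → φ (flip i x) ≟ c) id

  ∑-adjacency-colourClass : ∀ x → ∑[ c < k ] adjacency (colourClass φ c) x ≡ parity n
  ∑-adjacency-colourClass x = begin
    ∑[ c < k ] ∑[ i < n ] colourClass φ c (flip i x)  ≡⟨ ∑-comm (λ c i → colourClass φ c (flip i x)) ⟩
    ∑[ i < n ] ∑[ c < k ] colourClass φ c (flip i x)  ≡⟨ sum-cong-≗ (λ i → ∑-indicator (φ (flip i x))) ⟩
    ∑[ i < n ] 1ℙ                                     ≡⟨ ∑-1ℙ n ⟩
    parity n                                          ∎

  adjacency-ownColour : Proper φ → ∀ x → adjacency (colourClass φ (φ x)) x ≡ 0ℙ
  adjacency-ownColour proper x = begin
    ∑[ i < n ] colourClass φ (φ x) (flip i x)  ≡⟨ sum-cong-≗ (λ i → colourClass-≢ (proper x i ∘ sym)) ⟩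
    ∑[ i < n ] 0ℙ                              ≡⟨ sum-replicate-zero n ⟩
    0ℙ                                         ∎

  oddColour : IsOddColoring φ → 1 ≤ n → ∀ x → ∃ λ c → adjacency (colourClass φ c) x ≡ 1ℙ
  oddColour (_ , odd) 1≤n x =
    map₂ (λ {c} o → trans (sym (nbrCount-parity x c)) (odd⇒parity≡1ℙ (nbrCount φ x c) o)) (odd x 1≤n)

  isOddColoring : Proper φ → (∀ x → ∃ λ c → adjacency (colourClass φ c) x ≡ 1ℙ) → IsOddColoring φ
  isOddColoring proper odd = proper , λ x _ →
    map₂ (λ {c} o → parity≡1ℙ⇒odd (nbrCount φ x c) (trans (nbrCount-parity x c) o)) (odd x)

module _ {n k} (φ : Vertex n → Fin (suc k)) where

  ∑-adjacency-otherColours : Proper φ → ∀ x →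
    ∑[ j < k ] adjacency (colourClass φ (punchIn (φ x) j)) x ≡ parity n
  ∑-adjacency-otherColours proper x = begin
    ∑[ j < k ] g (punchIn (φ x) j)
      ≡⟨ cong (_+ ∑[ j < k ] g (punchIn (φ x) j)) (adjacency-ownColour φ proper x) ⟨
    g (φ x) + ∑[ j < k ] g (punchIn (φ x) j)  ≡⟨ sum-remove g ⟨
    ∑[ c < suc k ] g c                        ≡⟨ ∑-adjacency-colourClass φ x ⟩
    parity n                                  ∎
    where
    g : Fin (suc k) → Parity
    g c = adjacency (colourClass φ c) x

  oddOtherColour : IsOddColoring φ → 1 ≤ n → ∀ x →
    ∃ λ j → adjacency (colourClass φ (punchIn (φ x) j)) x ≡ 1ℙ
  oddOtherColour φ-odd 1≤n x with oddColour φ φ-odd 1≤n x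
  ... | c , odd-c =
    punchOut φx≢c , trans (cong (λ c → adjacency (colourClass φ c) x) (punchIn-punchOut φx≢c)) odd-c
    where
    φx≢c : φ x ≢ c
    φx≢c refl = p≢p⁻¹ 0ℙ (trans (sym (adjacency-ownColour φ (proj₁ φ-odd) x)) odd-c)

origin : ∀ n → Vertex n
origin n = replicate n false

¬HasOddColoring-0 : ∀ n → ¬ HasOddColoring n 0
¬HasOddColoring-0 n (φ , _) with φ (origin n)
... | ()

¬HasOddColoring-1 : ∀ m → ¬ HasOddColoring (suc m) 1
¬HasOddColoring-1 m (φ , proper , _) with φ (origin (suc m)) | φ (flip zero (origin (suc m)))
                                        | proper (origin (suc m)) zero
... | zero | zero | φx≢φx′ = φx≢φx′ refl

¬HasOddColoring-2 : ∀ {n} → Even n → 1 ≤ n → ¬ HasOddColoring n 2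
¬HasOddColoring-2 {n} even 1≤n (φ , φ-odd) with oddOtherColour φ φ-odd 1≤n (origin n)
... | zero , odd = p≢p⁻¹ 1ℙ (begin
  1ℙ + 0ℙ              ≡⟨ cong (_+ 0ℙ) odd ⟨
  ∑[ j < 1 ] g j       ≡⟨ ∑-adjacency-otherColours φ (proj₁ φ-odd) (origin n) ⟩
  parity n             ≡⟨ even⇒parity≡0ℙ n even ⟩
  0ℙ                   ∎)
  where
  g : Fin 1 → Parity
  g j = adjacency (colourClass φ (punchIn (φ (origin n)) j)) (origin n)

module _ {n} (φ : Vertex n → Fin 3) (φ-odd : IsOddColoring φ) (1≤n : 1 ≤ n) (even : Even n) where

  private
    parity≡0ℙ : parity n ≡ 0ℙ
    parity≡0ℙ = even⇒parity≡0ℙ n even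

  -- Both colours other than φ y are odd at y: their counts agree mod 2 and one is odd.
  adjacency-colourClass : ∀ c y → adjacency (colourClass φ c) y ≡ colourClass φ c y ⁻¹
  adjacency-colourClass c y with φ y ≟ c
  ... | yes refl = adjacency-ownColour φ (proj₁ φ-odd) y
  ... | no φy≢c with oddOtherColour φ φ-odd 1≤n y
  ...   | j , odd-j = begin
    adjacency (colourClass φ c) y  ≡⟨ cong (λ c → adjacency (colourClass φ c) y) (punchIn-punchOut φy≢c) ⟨
    h (punchOut φy≢c)              ≡⟨ ∑₂≡0ℙ⇒constant h ∑h≡0ℙ (punchOut φy≢c) j ⟩
    h j                            ≡⟨ odd-j ⟩
    1ℙ                             ∎
    where
    h : Fin 2 → Parity
    h j = adjacency (colourClass φ (punchIn (φ y) j)) y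
    ∑h≡0ℙ : ∑[ j < 2 ] h j ≡ 0ℙ
    ∑h≡0ℙ = trans (∑-adjacency-otherColours φ (proj₁ φ-odd) y) parity≡0ℙ

  adjacency-colourClass≡0ℙ : ∀ c x → adjacency (colourClass φ c) x ≡ 0ℙ
  adjacency-colourClass≡0ℙ c x = begin
    adjacency f x                       ≡⟨ cong (_+ adjacency f x) parity≡0ℙ ⟨
    parity n + adjacency f x            ≡⟨ adjacency-⁻¹ f x ⟨
    adjacency (λ y → f y ⁻¹) x          ≡⟨ sum-cong-≗ (λ i → adjacency-colourClass c (flip i x)) ⟨
    adjacency (adjacency f) x           ≡⟨ adjacency² f x ⟩
    parity n * f x                      ≡⟨ cong (_* f x) parity≡0ℙ ⟩
    0ℙ                                  ∎
    where
    f = colourClass φ c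

¬HasOddColoring-3 : ∀ {n} → Even n → 1 ≤ n → ¬ HasOddColoring n 3
¬HasOddColoring-3 {n} even 1≤n (φ , φ-odd) with oddColour φ φ-odd 1≤n (origin n)
... | c , odd-c =
  p≢p⁻¹ 0ℙ (trans (sym (adjacency-colourClass≡0ℙ φ φ-odd 1≤n even c (origin n))) odd-c)

weightParity : ∀ {n} → Vertex n → Parity
weightParity []      = 0ℙ
weightParity (b ∷ x) = toParity b + weightParity x

weightParity-flip : ∀ {n} (i : Fin n) x → weightParity (flip i x) ≡ weightParity x ⁻¹
weightParity-flip zero    (false ∷ x) = refl
weightParity-flip zero    (true  ∷ x) = sym (⁻¹-involutive (weightParity x))
weightParity-flip (suc i) (b ∷ x) = trans (cong (toParity b +_) (weightParity-flip i x)) (+⁻¹ b)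
  where
  +⁻¹ : ∀ b → toParity b + weightParity x ⁻¹ ≡ (toParity b + weightParity x) ⁻¹
  +⁻¹ false = refl
  +⁻¹ true  = refl

weightColoring : ∀ {n} → Vertex n → Fin 2
weightColoring x = fromParity (weightParity x)

weightColoring-isOddColoring : ∀ {n} → Odd n → IsOddColoring (weightColoring {n})
weightColoring-isOddColoring {n} n-odd = isOddColoring ψ proper odd
  where
  ψ : Vertex n → Fin 2
  ψ = weightColoring
  proper : Proper ψ
  proper x i eq = p≢p⁻¹ (weightParity x) (trans (fromParity-injective eq) (weightParity-flip i x))
  odd : ∀ x → ∃ λ c → adjacency (colourClass ψ c) x ≡ 1ℙ
  odd x = c , (begin
    ∑[ i < n ] colourClass ψ c (flip i x)
      ≡⟨ sum-cong-≗ (λ i → colourClass-≡ ψ {c} {flip i x} (cong fromParity (weightParity-flip i x))) ⟩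
    ∑[ i < n ] 1ℙ  ≡⟨ ∑-1ℙ n ⟩
    parity n       ≡⟨ odd⇒parity≡1ℙ n n-odd ⟩
    1ℙ             ∎)
    where
    c = fromParity (weightParity x ⁻¹)

weightHeadColoring : ∀ {m} → Vertex (suc m) → Fin 4
weightHeadColoring x = combine (fromParity (weightParity x)) (fromParity (toParity (head x)))

weightHeadColoring-weightParity : ∀ {m} (x y : Vertex (suc m)) →
  weightHeadColoring x ≡ weightHeadColoring y → weightParity x ≡ weightParity y
weightHeadColoring-weightParity x y eq = fromParity-injective
  (combine-injectiveˡ (fromParity (weightParity x)) (fromParity (toParity (head x)))
                      (fromParity (weightParity y)) (fromParity (toParity (head y))) eq)

weightHeadColoring-head : ∀ {m} (x y : Vertex (suc m)) →
  weightHeadColoring x ≡ weightHeadColoring y → toParity (head x) ≡ toParity (head y)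
weightHeadColoring-head x y eq = fromParity-injective
  (combine-injectiveʳ (fromParity (weightParity x)) (fromParity (toParity (head x)))
                      (fromParity (weightParity y)) (fromParity (toParity (head y))) eq)

weightHeadColoring-isOddColoring : ∀ {m} → IsOddColoring (weightHeadColoring {m})
weightHeadColoring-isOddColoring {m} = isOddColoring ψ proper odd
  where
  ψ : Vertex (suc m) → Fin 4
  ψ = weightHeadColoring
  proper : Proper ψ
  proper x i eq = p≢p⁻¹ (weightParity x)
    (trans (weightHeadColoring-weightParity x (flip i x) eq) (weightParity-flip i x))
  odd : ∀ x → ∃ λ c → adjacency (colourClass ψ c) x ≡ 1ℙ
  odd x@(b ∷ _) = c , (begin
    colourClass ψ c (flip zero x) + ∑[ j < m ] colourClass ψ c (flip (suc j) x)
      ≡⟨ cong₂ _+_ (colourClass-≡ ψ {c} {flip zero x} refl)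
                   (sum-cong-≗ (λ j → colourClass-≢ ψ {c} {flip (suc j) x} (headDiffers j))) ⟩
    1ℙ + ∑[ j < m ] 0ℙ  ≡⟨ cong (1ℙ +_) (sum-replicate-zero m) ⟩
    1ℙ                  ∎)
    where
    c = ψ (flip zero x)
    headDiffers : ∀ j → ψ (flip (suc j) x) ≢ c
    headDiffers j eq = p≢p⁻¹ (toParity b)
      (trans (weightHeadColoring-head (flip (suc j) x) (flip zero x) eq) (toParity-not b))

theorem1 : (n : ℕ) → 1 ≤ n →
    (Odd n → OddChromaticNumber n 2) × (Even n → OddChromaticNumber n 4)
theorem1 (suc m) 1≤n =
  (λ odd  → (weightColoring , weightColoring-isOddColoring odd) , fewerThan2) ,
  (λ even → (weightHeadColoring , weightHeadColoring-isOddColoring) , fewerThan4 even)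
  where
  fewerThan2 : ∀ k → k < 2 → ¬ HasOddColoring (suc m) k
  fewerThan2 0 _ = ¬HasOddColoring-0 (suc m)
  fewerThan2 1 _ = ¬HasOddColoring-1 m
  fewerThan2 (suc (suc k)) (s≤s (s≤s ()))
  fewerThan4 : Even (suc m) → ∀ k → k < 4 → ¬ HasOddColoring (suc m) k
  fewerThan4 _    0 _ = ¬HasOddColoring-0 (suc m)
  fewerThan4 _    1 _ = ¬HasOddColoring-1 m
  fewerThan4 even 2 _ = ¬HasOddColoring-2 even 1≤n
  fewerThan4 even 3 _ = ¬HasOddColoring-3 even 1≤n
  fewerThan4 _ (suc (suc (suc (suc k)))) (s≤s (s≤s (s≤s (s≤s ()))))
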